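{- For every $r\in \mathbb{N}$ and every finite simple graph $G$, we have $\operatorname{cw}_r(G)\leq \operatorname{scol}_{4r}(G)$.
   Context: All graphs are finite, simple and undirected; $\mathbb{N}=\{1,2,\dots\}$ and $[a,b]=\{a,\dots,b\}$. For a graph $G$, a total order $\preceq$ of $V(G)$, a vertex $v$ and an integer $s\ge 1$, let $R(G,\preceq,v,s)$ be the set of vertices $w$ for which there is a path $v=w_0,w_1,\dots,w_{s'}=w$ of length $s'\in[0,s]$ with $w\preceq v$ and $v\prec w_i$ for all $i\in[s'-1]$. The $s$-strong colouring number $\operatorname{scol}_s(G)$ is the minimum, over all total orders $\preceq$ of $V(G)$, of $\max_{v\in V(G)}|R(G,\preceq,v,s)|$. Cop-width game with radius $r$ and width $k$ on $G$: initially the cops occupy a set $C_0\subseteq V(G)$ with $|C_0|\le k$ and the robber chooses a vertex $x_0$. In each round $i\ge1$, the cops announce a new set $C_i\subseteq V(G)$ with $|C_i|\le k$ (cops fly by helicopter, so $C_i$ is arbitrary); the robber, knowing $C_i$, then moves from $x_{i-1}$ to a vertex $x_i$ along a path in $G$ of length at most $r$ that contains no vertex of $C_{i-1}\cap C_i$ (the cops that stay on the ground). The robber is caught in round $i$ if $x_i\in C_i$. The radius-$r$ cop-width $\operatorname{cw}_r(G)$ is the least $k\in\mathbb{N}$ such that the cops have a strategy guaranteeing that the robber is caught after finitely many rounds. -}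

module Defs where

open import Level using (0ℓ)
open import Data.Nat using (ℕ; suc; _≤_)
open import Data.Fin using (Fin)
open import Data.Fin.Subset using (Subset; _∈_; _∉_; _∩_; ∣_∣)
open import Data.List using (List; []; _∷_; _++_; length)
open import Data.List.Relation.Unary.All using (All)
open import Data.List.Relation.Unary.Linked using (Linked)
open import Data.List.Relation.Unary.Unique.Propositional using (Unique)
import Data.List.Membership.Propositional as LMem
open import Data.Product using (Σ; ∃; _×_)
open import Data.Sum using (_⊎_)
open import Relation.Nullary using (¬_)
open import Relation.Binary using (Rel; Decidable; IsTotalOrder; Symmetric; Irreflexive)
open import Relation.Binary.PropositionalEquality using (_≡_; _≢_)

record Graph (n : ℕ) : Set₁ where
  field
    Adj    : Rel (Fin n) 0ℓ
    sym    : Symmetric Adj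
    irrefl : Irreflexive _≡_ Adj
    adj?   : Decidable Adj
open Graph public

module _ {n : ℕ} (G : Graph n) where

  -- (u ∷ mids ++ w ∷ []) is a path in G (consecutive vertices adjacent,
  -- all vertices distinct) from u to w with internal vertices mids;
  -- its length is suc (length mids).
  IsPath : Fin n → List (Fin n) → Fin n → Set
  IsPath u mids w =
    Linked (Adj G) (u ∷ mids ++ w ∷ []) × Unique (u ∷ mids ++ w ∷ [])

  InR : (_⪯_ : Rel (Fin n) 0ℓ) → Fin n → ℕ → Fin n → Set
  InR _⪯_ v s w =
    w ⪯ v ×
    ( (v ≡ w)
    ⊎ Σ (List (Fin n)) (λ mids →
        IsPath v mids w × suc (length mids) ≤ s
        × All (λ x → (v ⪯ x) × (v ≢ x)) mids) )

  AtMost : ℕ → (Fin n → Set) → Set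
  AtMost k P = Σ (List (Fin n)) (λ xs →
    length xs ≤ k × (∀ v → P v → LMem._∈_ v xs))

  ScolAtMost : ℕ → ℕ → Set₁
  ScolAtMost s k = Σ (Rel (Fin n) 0ℓ) (λ _⪯_ →
    IsTotalOrder _≡_ _⪯_ × (∀ v → AtMost k (InR _⪯_ v s)))

  RobberMove : ℕ → Subset n → Fin n → Fin n → Set
  RobberMove r Ground x x' =
      (x ≡ x' × x ∉ Ground)
    ⊎ Σ (List (Fin n)) (λ mids →
        IsPath x mids x' × suc (length mids) ≤ r
        × All (λ y → y ∉ Ground) (x ∷ mids ++ x' ∷ []))

  -- CopsWin r k C x : the cops currently occupying C (previous round), with
  -- the robber on x (not yet caught), have a strategy with width k that
  -- guarantees capture after finitely many further rounds.  (Inductive, so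
  -- every play consistent with the strategy is finite; the strategy may
  -- depend on the whole history.)
  data CopsWin (r k : ℕ) : Subset n → Fin n → Set where
    step : ∀ {C x} (C' : Subset n) → ∣ C' ∣ ≤ k →
           (∀ x' → RobberMove r (C ∩ C') x x' → x' ∈ C' ⊎ CopsWin r k C' x') →
           CopsWin r k C x

  CopsWinGame : ℕ → ℕ → Set
  CopsWinGame r k = Σ (Subset n) (λ C₀ → ∣ C₀ ∣ ≤ k × (∀ x₀ → CopsWin r k C₀ x₀))

  -- cw_r(G) ≤ k : some k' ∈ ℕ = {1,2,…} with k' ≤ k lets the cops win.
  CwAtMost : ℕ → ℕ → Set
  CwAtMost r k = Σ ℕ (λ k' → 1 ≤ k' × k' ≤ k × CopsWinGame r k')

{-# OPTIONS --safe #-}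
module Submission where

open import Defs hiding (sym)
open import Level using (0ℓ)
open import Data.Nat using (ℕ; zero; suc; _+_; _*_; _≤_; _<_; z≤n; s≤s)
open import Data.Nat.Properties
  using (≤-refl; ≤-reflexive; ≤-trans; <⇒≤; <-≤-trans; m≤n⇒m≤1+n; m≤m+n; m+n≤o⇒m≤o;
         +-comm; +-assoc; +-suc; +-mono-≤; +-monoʳ-≤; +-monoʳ-<)
open import Data.Fin using (Fin)
open import Data.Fin.Properties using (any?) renaming (_≟_ to _≟ᶠ_)
open import Data.Fin.Induction using (po-noetherian)
open import Data.Fin.Subset using (Subset; inside; outside; ⊥; _∩_; ∣_∣)
  renaming (_∈_ to _∈ˢ_; _∉_ to _∉ˢ_)
open import Data.Fin.Subset.Properties using (∣p∣≤∣x∷p∣; ∣⊥∣≡0; x∈p∩q⁺)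
open import Data.Vec.Base using (_∷_; _[_]≔_)
open import Data.Vec.Properties using ([]≔-updates; []≔-minimal)
open import Data.List
  using (List; []; _∷_; _++_; _∷ʳ_; length; filter; foldr; allFin; initLast; _∷ʳ′_)
open import Data.List.Properties using (length-++)
open import Data.List.Relation.Unary.All as All using (All; []; _∷_)
open import Data.List.Relation.Unary.All.Properties using (¬Any⇒All¬; ++⁺)
open import Data.List.Relation.Unary.Any using (here; there)
import Data.List.Relation.Unary.First as First
open import Data.List.Relation.Unary.First.Properties using (toView)
open import Data.List.Relation.Unary.Linked using (Linked; [-]; _∷_)
open import Data.List.Relation.Unary.AllPairs using ([]; _∷_)
open import Data.List.Relation.Unary.Unique.Propositional using (Unique)
open import Data.List.Membership.Propositional using (_∈_; _∉_)
open import Data.List.Membership.Propositional.Properties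
  using (∈-filter⁺; ∈-filter⁻; ∈-allFin; ∈-++⁺ˡ; ∈-++⁺ʳ)
open import Data.List.Relation.Binary.Subset.Propositional using (_⊆_)
open import Data.Maybe using (Maybe; nothing; just)
open import Data.Product using (∃; _×_; _,_; proj₁; proj₂)
open import Data.Sum as Sum using (_⊎_; inj₁; inj₂)
open import Data.Unit using (⊤; tt)
open import Function using (_∘_; flip)
open import Induction.WellFounded using (Acc; acc)
open import Relation.Nullary using (¬_; yes; no; contradiction)
open import Relation.Nullary.Decidable using (_×-dec_; _⊎-dec_; toSum)
open import Relation.Unary using (Pred; Decidable)
open import Relation.Binary using (Rel; IsTotalOrder; TotalOrder; DecidableEquality)
import Relation.Binary.Definitions as B
open import Relation.Binary.Consequences using (total∧dec⇒dec)
open import Relation.Binary.PropositionalEquality using (_≡_; _≢_; refl; sym; trans; subst)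

-- Fix an order ⪯ witnessing scol₄ᵣ(G) ≤ k and write R(v) for R(G, ⪯, v, 4r).
-- The cops always occupy R(u) for an anchor u such that the robber stands
-- strictly above u and is reached from u by a walk of length ≤ 2r through
-- vertices ⪰ u.  In the next round the new anchor u′ is the ⪯-least vertex the
-- robber could reach in ≤ r steps without going below u, and the cops fly to
-- R(u′).  Should the robber's move leave the region above u, its first vertex w
-- outside satisfies w ⪯ u ⪯ u′ and lies in R(u) (through x, a walk of length
-- < 3r) as well as in R(u′) (a walk of length < 2r), so it is guarded by a cop
-- that stays on the ground.  Hence the robber stays in the region, all his
-- vertices are ⪰ u′, and u′ is a valid anchor for his new position unless he
-- stands on u′ and is caught.  Anchors increase strictly, so the game ends.

length<length-++-∷ : ∀ {A : Set} (pre : List A) {w post} → length pre < length (pre ++ w ∷ post)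
length<length-++-∷ []        = s≤s z≤n
length<length-++-∷ (_ ∷ pre) = s≤s (length<length-++-∷ pre)

length-∷ʳ : ∀ {A : Set} (xs : List A) x → length (xs ∷ʳ x) ≡ suc (length xs)
length-∷ʳ xs x = trans (length-++ xs) (+-comm (length xs) 1)

Unique[xs∷ʳx]⇒x∉xs : ∀ {A : Set} {xs : List A} {x} → Unique (xs ∷ʳ x) → x ∉ xs
Unique[xs∷ʳx]⇒x∉xs {xs = _ ∷ ys} (y∉ ∷ _) (here refl) = All.lookup y∉ (∈-++⁺ʳ ys (here refl)) refl
Unique[xs∷ʳx]⇒x∉xs {xs = _ ∷ _}  (_ ∷ u)  (there x∈) = Unique[xs∷ʳx]⇒x∉xs u x∈

module Walks {A : Set} (R : Rel A 0ℓ) where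

  endpoint : A → List A → A
  endpoint a []       = a
  endpoint a (w ∷ ws) = endpoint w ws

  Walk : A → List A → A → Set
  Walk a ws b = Linked R (a ∷ ws) × endpoint a ws ≡ b

  endpoint-∈ : ∀ a ws → endpoint a ws ∈ a ∷ ws
  endpoint-∈ a []       = here refl
  endpoint-∈ a (w ∷ ws) = there (endpoint-∈ w ws)

  endpoint-∷ʳ : ∀ a ws b → endpoint a (ws ∷ʳ b) ≡ b
  endpoint-∷ʳ a []       b = refl
  endpoint-∷ʳ a (w ∷ ws) b = endpoint-∷ʳ w ws b

  walk-++ : ∀ {a b c ws vs} → Walk a ws b → Walk b vs c → Walk a (ws ++ vs) c
  walk-++ {ws = []}     (_ , refl)  q = q
  walk-++ {ws = w ∷ ws} (r ∷ l , e) q with walk-++ {ws = ws} (l , e) q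
  ... | l′ , e′ = r ∷ l′ , e′

  Linked-∷ʳ⇒walk : ∀ {a ws b} → Linked R (a ∷ ws ∷ʳ b) → Walk a (ws ∷ʳ b) b
  Linked-∷ʳ⇒walk {a} {ws} {b} l = l , endpoint-∷ʳ a ws b

  Linked-++-∷⁻ : ∀ {a} pre {w post} → Linked R (a ∷ pre ++ w ∷ post) →
                 Linked R (a ∷ pre) × R (endpoint a pre) w
  Linked-++-∷⁻ []        (r ∷ _) = [-] , r
  Linked-++-∷⁻ (p ∷ pre) (r ∷ l) with Linked-++-∷⁻ pre l
  ... | l′ , r′ = r ∷ l′ , r′

module Shortcutting {A : Set} (_≟_ : DecidableEquality A) (R : Rel A 0ℓ) where
  open Walks R
  open import Data.List.Membership.DecPropositional _≟_ using (_∈?_)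

  record PathWithin (a b : A) (ws : List A) : Set where
    field
      vertices : List A
      linked   : Linked R (a ∷ vertices)
      unique   : Unique (a ∷ vertices)
      ends-at  : endpoint a vertices ≡ b
      shorter  : length vertices ≤ length ws
      within   : vertices ⊆ ws

  suffixFrom : ∀ {a c xs} → a ∈ c ∷ xs → Linked R (c ∷ xs) → Unique (c ∷ xs) →
               PathWithin a (endpoint c xs) xs
  suffixFrom {xs = xs} (here refl) l u = record
    { vertices = xs ; linked = l ; unique = u ; ends-at = refl
    ; shorter = ≤-refl ; within = λ v∈ → v∈ }
  suffixFrom {xs = _ ∷ _} (there a∈) (_ ∷ l) (_ ∷ u) = record
    { vertices = vertices ; linked = linked ; unique = unique ; ends-at = ends-at
    ; shorter = m≤n⇒m≤1+n shorter ; within = there ∘ within }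
    where open PathWithin (suffixFrom a∈ l u)

  shortcut : ∀ {a ws} → Linked R (a ∷ ws) → PathWithin a (endpoint a ws) ws
  shortcut {ws = []} _ = record
    { vertices = [] ; linked = [-] ; unique = [] ∷ [] ; ends-at = refl ; shorter = z≤n ; within = λ () }
  shortcut {a} {w ∷ ws} (r ∷ l) with shortcut l
  ... | record { vertices = vs ; linked = l′ ; unique = u′ ; ends-at = e ; shorter = s ; within = sub }
    with a ∈? w ∷ vs
  ... | no a∉ = record
    { vertices = w ∷ vs ; linked = r ∷ l′ ; unique = ¬Any⇒All¬ (w ∷ vs) a∉ ∷ u′ ; ends-at = e
    ; shorter = s≤s s ; within = λ { (here eq) → here eq ; (there v∈) → there (sub v∈) } }
  ... | yes a∈ = record
    { vertices = vertices ; linked = linked ; unique = unique ; ends-at = trans ends-at e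
    ; shorter = m≤n⇒m≤1+n (≤-trans shorter s) ; within = there ∘ sub ∘ within }
    where open PathWithin (suffixFrom a∈ l′ u′)

  walk⇒path : ∀ {a ws b} → Walk a ws b →
              a ≡ b ⊎ ∃ λ mids → (Linked R (a ∷ mids ∷ʳ b) × Unique (a ∷ mids ∷ʳ b))
                                 × suc (length mids) ≤ length ws × mids ⊆ ws
  walk⇒path {a} {ws} (l , e) with shortcut l
  ... | record { vertices = vs ; linked = l′ ; unique = u′ ; ends-at = e′ ; shorter = s ; within = sub }
    with initLast vs
  ... | [] = inj₁ (trans e′ e)
  ... | mids ∷ʳ′ b′ with trans (sym (endpoint-∷ʳ a mids b′)) (trans e′ e)
  ...   | refl =
    inj₂ (mids , (l′ , u′) , subst (_≤ length ws) (length-∷ʳ mids b′) s , sub ∘ ∈-++⁺ˡ)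

∣p[i]≔inside∣≤1+∣p∣ : ∀ {n} (p : Subset n) i → ∣ p [ i ]≔ inside ∣ ≤ suc ∣ p ∣
∣p[i]≔inside∣≤1+∣p∣ (s ∷ p)       Fin.zero    = s≤s (∣p∣≤∣x∷p∣ s p)
∣p[i]≔inside∣≤1+∣p∣ (inside ∷ p)  (Fin.suc i) = s≤s (∣p[i]≔inside∣≤1+∣p∣ p i)
∣p[i]≔inside∣≤1+∣p∣ (outside ∷ p) (Fin.suc i) = ∣p[i]≔inside∣≤1+∣p∣ p i

fromList : ∀ {n} → List (Fin n) → Subset n
fromList = foldr (λ v p → p [ v ]≔ inside) ⊥

∣fromList∣≤length : ∀ {n} (xs : List (Fin n)) → ∣ fromList xs ∣ ≤ length xs
∣fromList∣≤length {n} []   = ≤-reflexive (∣⊥∣≡0 n)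
∣fromList∣≤length (x ∷ xs) =
  ≤-trans (∣p[i]≔inside∣≤1+∣p∣ (fromList xs) x) (s≤s (∣fromList∣≤length xs))

∈-fromList : ∀ {n} {v : Fin n} {xs} → v ∈ xs → v ∈ˢ fromList xs
∈-fromList {xs = x ∷ xs} (here refl) = []≔-updates (fromList xs) x
∈-fromList {v = v} {x ∷ xs} (there v∈) with v ≟ᶠ x
... | yes refl = []≔-updates (fromList xs) x
... | no v≢x   = []≔-minimal (fromList xs) v x v≢x (∈-fromList v∈)

module _ {n : ℕ} {_⪯_ : Rel (Fin n) 0ℓ} (isTotalOrder : IsTotalOrder _≡_ _⪯_) where
  private
    totalOrder : TotalOrder 0ℓ 0ℓ 0ℓ
    totalOrder = record { isTotalOrder = isTotalOrder }
  open import Data.List.Extrema totalOrder using (min; min≤xs; argmin-sel)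

  least : ∀ {P : Pred (Fin n) 0ℓ} → Decidable P → ∀ {x} → P x →
          ∃ λ u → P u × (∀ {y} → P y → u ⪯ y)
  least {P} P? {x} Px = min x candidates , P-min , min-least
    where
    candidates = filter P? (allFin n)
    P-min : P (min x candidates)
    P-min with argmin-sel (λ v → v) x candidates
    ... | inj₁ eq   = subst P (sym eq) Px
    ... | inj₂ min∈ = proj₂ (∈-filter⁻ P? {xs = allFin n} min∈)
    min-least : ∀ {y} → P y → min x candidates ⪯ y
    min-least {y} Py = All.lookup (min≤xs x candidates) (∈-filter⁺ P? (∈-allFin y) Py)

module Reachability {n : ℕ} (G : Graph n) {P : Pred (Fin n) 0ℓ} (P? : Decidable P) (x : Fin n) where
  open Walks (Adj G)

  Reach : ℕ → Pred (Fin n) 0ℓ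
  Reach zero    y = x ≡ y
  Reach (suc j) y = Reach j y ⊎ (P y × ∃ λ z → Reach j z × Adj G z y)

  reach? : ∀ j → Decidable (Reach j)
  reach? zero    y = x ≟ᶠ y
  reach? (suc j) y = reach? j y ⊎-dec (P? y ×-dec any? (λ z → reach? j z ×-dec adj? G z y))

  Reach-mono : ∀ {i j y} → i ≤ j → Reach i y → Reach j y
  Reach-mono {j = zero}      z≤n       q                      = q
  Reach-mono {zero}  {suc j} _         q                      = inj₁ (Reach-mono z≤n q)
  Reach-mono {suc i} {suc j} (s≤s i≤j) (inj₁ q)               = inj₁ (Reach-mono i≤j q)
  Reach-mono {suc i} {suc j} (s≤s i≤j) (inj₂ (Py , z , q , e)) = inj₂ (Py , z , Reach-mono i≤j q , e)

  Reach-start : ∀ j → Reach j x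
  Reach-start j = Reach-mono z≤n refl

  Reach⇒P : P x → ∀ {j y} → Reach j y → P y
  Reach⇒P Px {zero}  refl            = Px
  Reach⇒P Px {suc j} (inj₁ q)        = Reach⇒P Px q
  Reach⇒P Px {suc j} (inj₂ (Py , _)) = Py

  Reach⇒walk : ∀ {j y} → Reach j y → ∃ λ ws → Walk y ws x × length ws ≤ j × All (Reach j) ws
  Reach⇒walk {zero}  refl = [] , ([-] , refl) , z≤n , []
  Reach⇒walk {suc j} (inj₁ q) with Reach⇒walk q
  ... | ws , walk , len , reach = ws , walk , m≤n⇒m≤1+n len , All.map inj₁ reach
  Reach⇒walk {suc j} (inj₂ (_ , z , q , e)) with Reach⇒walk q
  ... | ws , (l , end) , len , reach =
    z ∷ ws , (Graph.sym G e ∷ l , end) , s≤s len , All.map inj₁ (q ∷ reach)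

  walk⇒Reach : ∀ {i j a ws} → i + length ws ≤ j → Reach i a →
               Linked (Adj G) (a ∷ ws) → All P ws → All (Reach j) (a ∷ ws)
  walk⇒Reach {i} {ws = []} len q _ _ = Reach-mono (m+n≤o⇒m≤o i len) q ∷ []
  walk⇒Reach {i} {j} {ws = _ ∷ ws} len q (e ∷ l) (Pw ∷ Ps) =
    Reach-mono (m+n≤o⇒m≤o i len) q
    ∷ walk⇒Reach (subst (_≤ j) (+-suc i (length ws)) len) (inj₂ (Pw , _ , q , e)) l Ps

module UpWalks {n : ℕ} (G : Graph n) (_⪯_ : Rel (Fin n) 0ℓ) where
  open Walks (Adj G)
  open Shortcutting _≟ᶠ_ (Adj G)

  UpWalk : Fin n → ℕ → Fin n → Set
  UpWalk u ℓ y = ∃ λ ws → Walk u ws y × length ws ≤ ℓ × All (u ⪯_) ws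

  upWalk-++ : ∀ {u ℓ m y z ws} → UpWalk u ℓ y → Walk y ws z → length ws ≤ m → All (u ⪯_) ws →
              UpWalk u (ℓ + m) z
  upWalk-++ (vs , walk , len , above) walk′ len′ above′ =
    vs ++ _ , walk-++ walk walk′ , ≤-trans (≤-reflexive (length-++ vs)) (+-mono-≤ len len′)
    , ++⁺ above above′

  upWalk-step⇒InR : ∀ {u ℓ y b s} → UpWalk u ℓ y → Adj G y b → b ⪯ u → ℓ < s →
                    InR G _⪯_ u s b
  upWalk-step⇒InR {u} {b = b} {s} (ws , walk , len , above) e b⪯u ℓ<s
    with walk⇒path (walk-++ walk (e ∷ [-] , refl))
  ... | inj₁ u≡b = b⪯u , inj₁ u≡b
  ... | inj₂ (mids , path@(_ , u∉ ∷ unique) , len′ , mids⊆) =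
    b⪯u , inj₂ (mids , path , ≤-trans len′ walk-short , All.tabulate strictly-above)
    where
    walk-short : length (ws ∷ʳ b) ≤ s
    walk-short = ≤-trans (≤-reflexive (length-∷ʳ ws b)) (≤-trans (s≤s len) ℓ<s)
    weakly-above-or-b : All (λ z → u ⪯ z ⊎ z ≡ b) (ws ∷ʳ b)
    weakly-above-or-b = ++⁺ (All.map inj₁ above) (inj₂ refl ∷ [])
    strictly-above : ∀ {z} → z ∈ mids → u ⪯ z × u ≢ z
    strictly-above z∈ with All.lookup weakly-above-or-b (mids⊆ z∈)
    ... | inj₁ u⪯z  = u⪯z , All.lookup u∉ (∈-++⁺ˡ z∈)
    ... | inj₂ refl = contradiction z∈ (Unique[xs∷ʳx]⇒x∉xs unique)

robberMove⇒walk : ∀ {n} (G : Graph n) {r C x x′} → RobberMove G r C x x′ →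
                  ∃ λ ws → Walks.Walk (Adj G) x ws x′ × length ws ≤ r × All (_∉ˢ C) ws
robberMove⇒walk G (inj₁ (refl , _)) = [] , ([-] , refl) , z≤n , []
robberMove⇒walk G {r} {x′ = x′} (inj₂ (mids , (l , _) , len , _ ∷ free)) =
  mids ∷ʳ x′ , Walks.Linked-∷ʳ⇒walk (Adj G) l , subst (_≤ r) (sym (length-∷ʳ mids x′)) len
  , free

atMost⇒1≤ : ∀ {n} (G : Graph n) {k P v} → AtMost G k P → P v → 1 ≤ k
atMost⇒1≤ _ (_ ∷ _ , len , _) _ = ≤-trans (s≤s z≤n) len
atMost⇒1≤ _ ([] , _ , covers) Pv with covers _ Pv
... | ()

module CopStrategy {n : ℕ} (G : Graph n) (r k : ℕ) {_⪯_ : Rel (Fin n) 0ℓ}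
    (isTotalOrder : IsTotalOrder _≡_ _⪯_)
    (R-small : ∀ v → AtMost G k (InR G _⪯_ v (4 * r))) where

  open IsTotalOrder isTotalOrder using (isPartialOrder; total; antisym; reflexive)
    renaming (trans to ⪯-trans)
  open import Relation.Binary.Construct.NonStrictToStrict _≡_ _⪯_ using ()
    renaming (_<_ to _≺_; <-decidable to ≺-decidable)
  open Walks (Adj G)
  open UpWalks G _⪯_

  _≺?_ : B.Decidable _≺_
  _≺?_ = ≺-decidable _≟ᶠ_ (total∧dec⇒dec reflexive antisym total _≟ᶠ_)

  ⊀⇒⪰ : ∀ {u w} → ¬ u ≺ w → w ⪯ u
  ⊀⇒⪰ {u} {w} u⊀w with total w u | u ≟ᶠ w
  ... | inj₁ w⪯u | _        = w⪯u
  ... | inj₂ u⪯w | yes refl = u⪯w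
  ... | inj₂ u⪯w | no u≢w   = contradiction (u⪯w , u≢w) u⊀w

  InR-self : ∀ {v s} → InR G _⪯_ v s v
  InR-self = reflexive refl , inj₁ refl

  cops : Fin n → Subset n
  cops v = fromList (proj₁ (R-small v))

  ∣cops∣≤k : ∀ v → ∣ cops v ∣ ≤ k
  ∣cops∣≤k v = ≤-trans (∣fromList∣≤length (proj₁ (R-small v))) (proj₁ (proj₂ (R-small v)))

  InR⇒∈cops : ∀ {v b} → InR G _⪯_ v (4 * r) b → b ∈ˢ cops v
  InR⇒∈cops {v} b∈R = ∈-fromList (proj₂ (proj₂ (R-small v)) _ b∈R)

  -- The state before the first anchor is chosen is `nothing`: no cops on the
  -- ground and no restriction on the robber.
  Region : Maybe (Fin n) → Pred (Fin n) 0ℓ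
  Region nothing  _ = ⊤
  Region (just u) y = u ≺ y

  region? : ∀ mu → Decidable (Region mu)
  region? nothing  _ = yes tt
  region? (just u) y = u ≺? y

  Guard : Maybe (Fin n) → Subset n
  Guard nothing  = ⊥
  Guard (just u) = cops u

  Anchored : Maybe (Fin n) → Fin n → Set
  Anchored nothing  _ = ⊤
  Anchored (just u) x = u ≺ x × UpWalk u (r + r) x

  anchored⇒region : ∀ mu {x} → Anchored mu x → Region mu x
  anchored⇒region nothing  _         = tt
  anchored⇒region (just u) (u≺x , _) = u≺x

  first-exit-guarded : ∀ mu {x u′ pre p w} → Anchored mu x → Region mu u′ → UpWalk u′ r x →
                       Walk x pre p → Adj G p w → length pre < r →
                       All (Region mu) pre → All (u′ ⪯_) pre → ¬ Region mu w →
                       w ∈ˢ Guard mu ∩ cops u′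
  first-exit-guarded nothing _ _ _ _ _ _ _ _ w∉ = contradiction tt w∉
  first-exit-guarded (just u) (_ , from-u) (u⪯u′ , _) from-u′ walk e pre<r above above′ w∉ =
    x∈p∩q⁺ ( InR⇒∈cops (upWalk-step⇒InR (upWalk-++ from-u walk ≤-refl (All.map proj₁ above))
                                           e w⪯u (≤-trans (+-monoʳ-< (r + r) pre<r) 3r≤4r))
           , InR⇒∈cops (upWalk-step⇒InR (upWalk-++ from-u′ walk ≤-refl above′)
                                           e (⪯-trans w⪯u u⪯u′) (≤-trans (+-monoʳ-< r pre<r) 2r≤4r)) )
    where
    w⪯u = ⊀⇒⪰ w∉
    2r≤4r : r + r ≤ 4 * r
    2r≤4r = +-monoʳ-≤ r (m≤m+n r _)
    3r≤4r : r + r + r ≤ 4 * r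
    3r≤4r = ≤-trans (≤-reflexive (+-assoc r r r)) (+-monoʳ-≤ r (+-monoʳ-≤ r (m≤m+n r _)))

  module Round (mu : Maybe (Fin n)) (x : Fin n) where
    open Reachability G (region? mu) x

    private
      least-reachable : ∃ λ u → Reach r u × (∀ {y} → Reach r y → u ⪯ y)
      least-reachable = least isTotalOrder (reach? r) (Reach-start r)

    next : Fin n
    next = proj₁ least-reachable

    next-least : ∀ {y} → Reach r y → next ⪯ y
    next-least = proj₂ (proj₂ least-reachable)

    next∈region : Anchored mu x → Region mu next
    next∈region a = Reach⇒P (anchored⇒region mu a) (proj₁ (proj₂ least-reachable))

    next-upWalk : UpWalk next r x
    next-upWalk with Reach⇒walk (proj₁ (proj₂ least-reachable))
    ... | ws , walk , len , reach = ws , walk , len , All.map next-least reach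

    walk-stays-in-region : ∀ {ws} → Anchored mu x → Linked (Adj G) (x ∷ ws) → length ws ≤ r →
                           All (_∉ˢ Guard mu ∩ cops next) ws → All (Region mu) ws
    walk-stays-in-region {ws} a l len free with First.first (toSum ∘ region? mu) ws
    ... | inj₂ in-region = in-region
    ... | inj₁ exit with toView exit
    ...   | First._++_∷_ {pre} in-region w∉ _ with Linked-++-∷⁻ pre l
    ...     | l-pre , e = contradiction
      (first-exit-guarded mu a (next∈region a) next-upWalk (l-pre , refl) e pre<r in-region
         (All.map next-least (All.tail (walk⇒Reach (<⇒≤ pre<r) refl l-pre in-region))) w∉)
      (All.lookup free (∈-++⁺ʳ pre (here refl)))
      where
      pre<r : length pre < r
      pre<r = <-≤-trans (length<length-++-∷ pre) len

    move-caught-or-anchored : ∀ {x′} → Anchored mu x → RobberMove G r (Guard mu ∩ cops next) x x′ →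
                              x′ ≡ next ⊎ Anchored (just next) x′
    move-caught-or-anchored {x′} a move with robberMove⇒walk G move
    ... | ws , (l , end) , len , free with x′ ≟ᶠ next
    ...   | yes x′≡next = inj₁ x′≡next
    ...   | no  x′≢next =
      inj₂ ( (next-least (All.lookup reach x′∈) , x′≢next ∘ sym)
           , upWalk-++ next-upWalk (l , end) len (All.map next-least (All.tail reach)) )
      where
      reach : All (Reach r) (x ∷ ws)
      reach = walk⇒Reach len refl l (walk-stays-in-region a l len free)
      x′∈ : x′ ∈ x ∷ ws
      x′∈ = subst (_∈ x ∷ ws) end (endpoint-∈ x ws)

  cops-round : ∀ mu {x} → Anchored mu x →
               (∀ {x′} → Anchored (just (Round.next mu x)) x′ →
                         CopsWin G r k (cops (Round.next mu x)) x′) →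
               CopsWin G r k (Guard mu) x
  cops-round mu {x} a continue = step (cops next) (∣cops∣≤k next) λ _ move →
    Sum.map (λ { refl → InR⇒∈cops InR-self }) continue (move-caught-or-anchored a move)
    where open Round mu x

  cops-win-anchored : ∀ u → Acc (flip _≺_) u → ∀ {x} → Anchored (just u) x →
                      CopsWin G r k (cops u) x
  cops-win-anchored u (acc rs) {x} a =
    cops-round (just u) a (cops-win-anchored _ (rs (Round.next∈region (just u) x a)))

  cops-win : ∀ x → CopsWin G r k ⊥ x
  cops-win x = cops-round nothing tt (cops-win-anchored _ (po-noetherian isPartialOrder _))

theorem3 : (n : ℕ) → 1 ≤ n → (G : Graph n) → (r : ℕ) → 1 ≤ r →
    (k : ℕ) → ScolAtMost G (4 * r) k → CwAtMost G r k
theorem3 zero    () G r _ k _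
theorem3 (suc m) _  G r _ k (_⪯_ , isTotalOrder , R-small) =
  k , atMost⇒1≤ G (R-small Fin.zero) InR-self , ≤-refl , ⊥ , ∣⊥∣≤k , cops-win
  where
  open CopStrategy G r k isTotalOrder R-small
  ∣⊥∣≤k : ∣ ⊥ {suc m} ∣ ≤ k
  ∣⊥∣≤k = ≤-trans (≤-reflexive (∣⊥∣≡0 (suc m))) z≤n
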